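{- Let $d\ge 2$ be an integer and let $G$ be any finite simple graph without isolated vertices. Then Dom has a winning strategy in the $(d:1)$-game on $G$ (regardless of which player makes the first turn).
   Context: For a vertex $v$, $N[v]$ denotes its closed neighborhood. In the Disjoint Domination Game setting, players Dom and Sepy color previously uncolored vertices of $G$ with purple or blue (either player may use either color); with $V_p,V_b$ the current color classes, coloring $v$ with $c$ is legal iff $v$ is uncolored and some $u\in N[v]$ has $N[u]\cap V_c=\emptyset$. The game terminates as soon as either (s) some vertex has its closed neighborhood entirely colored with one color (Sepy wins), or (d) both $V_p$ and $V_b$ are dominating sets of $G$ (Dom wins). In the $(d:s)$-game the players take turns; in each of his turns Dom sequentially makes exactly $d$ legal moves (fewer only if fewer legal moves remain), and in each of his turns Sepy sequentially makes at most $s$ legal moves (he may pass); legality of each single coloring is checked at the moment it is made. -}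

module Defs where

open import Data.Nat using (ℕ; zero; suc)
open import Data.Fin using (Fin; _≟_)
open import Data.Bool using (Bool; true; false)
open import Data.Maybe using (Maybe; just; nothing)
open import Data.Product using (Σ; ∃; ∃-syntax; _×_; _,_)
open import Data.Sum using (_⊎_)
open import Relation.Nullary using (¬_; yes; no)
open import Relation.Binary.PropositionalEquality using (_≡_; _≢_)

record SimpleGraph (n : ℕ) : Set where
  field
    adj     : Fin n → Fin n → Bool
    symm    : ∀ u v → adj u v ≡ adj v u
    loopless : ∀ v → adj v v ≡ false

open SimpleGraph public

module _ {n : ℕ} (G : SimpleGraph n) where

  Adj : Fin n → Fin n → Set
  Adj u v = adj G u v ≡ true

  NoIsolatedVertices : Set
  NoIsolatedVertices = ∀ v → ∃[ u ] Adj v u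

  InN : Fin n → Fin n → Set
  InN v u = u ≡ v ⊎ Adj v u

data Color : Set where
  purple blue : Color

Coloring : ℕ → Set
Coloring n = Fin n → Maybe Color

_[_≔_] : ∀ {n} → Coloring n → Fin n → Color → Coloring n
(σ [ v ≔ c ]) w with w ≟ v
... | yes _ = just c
... | no  _ = σ w

module _ {n : ℕ} (G : SimpleGraph n) where

  Legal : Coloring n → Fin n → Color → Set
  Legal σ v c = σ v ≡ nothing ×
    ∃[ u ] (InN G v u × (∀ w → InN G u w → σ w ≢ just c))

  SepyWon : Coloring n → Set
  SepyWon σ = ∃[ v ] ∃[ c ] (∀ w → InN G v w → σ w ≡ just c)

  Dominating : Coloring n → Color → Set
  Dominating σ c = ∀ v → ∃[ w ] (InN G v w × σ w ≡ just c)

  DomWon : Coloring n → Set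
  DomWon σ = ∀ c → Dominating σ c

  Ongoing : Coloring n → Set
  Ongoing σ = ¬ SepyWon σ × ¬ DomWon σ

-- Phases of the (d:1)-game: Dom in his turn with k single moves
-- still to make, or Sepy to make his turn (at most one move).
data Phase : Set where
  domPhase  : ℕ → Phase
  sepyPhase : Phase

-- DomForces G d s p σ : from position σ in phase p of the (d:s)-game
-- with s = 1, Dom has a strategy that wins against every play of Sepy.
-- (Inductive, i.e. Dom wins after finitely many moves.)
data DomForces {n : ℕ} (G : SimpleGraph n) (d : ℕ) : Phase → Coloring n → Set where
  won      : ∀ {p σ} → DomWon G σ → DomForces G d p σ
  domMove  : ∀ {k σ} v c → Ongoing G σ → Legal G σ v c →
             DomForces G d (domPhase k) (σ [ v ≔ c ]) →
             DomForces G d (domPhase (suc k)) σ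
  domStuck : ∀ {k σ} → Ongoing G σ → (∀ v c → ¬ Legal G σ v c) →
             DomForces G d sepyPhase σ →
             DomForces G d (domPhase (suc k)) σ
  domEnd   : ∀ {σ} → Ongoing G σ →
             DomForces G d sepyPhase σ →
             DomForces G d (domPhase zero) σ
  -- Sepy may pass or make one legal move; Dom must win in every case
  sepyTurn : ∀ {σ} → Ongoing G σ →
             DomForces G d (domPhase d) σ →
             (∀ v c → Legal G σ v c → DomForces G d (domPhase d) (σ [ v ≔ c ])) →
             DomForces G d sepyPhase σ

emptyColoring : ∀ {n} → Coloring n
emptyColoring _ = nothing

module Submission where

-- Call a coloured vertex supported if one of its neighbours has the other colour; if all coloured
-- vertices are supported, no closed neighbourhood is monochromatic. Dom keeps every coloured vertex
-- supported at the start of Sepy's turns, except possibly one vertex u that he coloured last, whose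
-- neighbourhood is still blank and which is robust: it has two neighbours, or all its neighbours are
-- leaves, which Sepy may not colour with u's colour. While some colour class fails to
-- dominate some N[u], a vertex near u can be coloured so as to keep this invariant. A Sepy move
-- leaves at most two unsupported vertices, and two answering moves (colouring a blank neighbour with
-- the opposite colour) restore the invariant. Every move colours a vertex, so the game ends, and
-- the invariant rules out Sepy's win.

open import Defs
open import Data.Bool using (true)
import Data.Bool.Properties as Bool
open import Data.Empty using (⊥-elim)
open import Data.Fin using (Fin; zero; suc; _≟_)
open import Data.Fin.Properties using (any?; all?; ¬∀⟶∃¬)
open import Data.Maybe using (Maybe; just; nothing)
open import Data.Maybe.Properties using (just-injective; ≡-dec)
open import Data.Nat using (ℕ; zero; suc; _+_; _≤_; _<_; z≤n; s≤s)
open import Data.Nat.Properties using (≤-refl; <-≤-trans; n≤1+n; +-mono-≤; +-mono-≤-<)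
open import Data.Product using (_×_; _,_; proj₁; ∃; ∃-syntax)
open import Data.Sum using (_⊎_; inj₁; inj₂)
open import Function using (_∘_; const)
open import Relation.Binary.Definitions using (DecidableEquality)
open import Relation.Binary.PropositionalEquality using (_≡_; _≢_; refl; sym; trans; cong; subst)
open import Relation.Nullary using (¬_; Dec; yes; no)
open import Relation.Nullary.Decidable using (_×-dec_; _⊎-dec_; ¬?)

other : Color → Color
other purple = blue
other blue   = purple

other-involutive : ∀ c → other (other c) ≡ c
other-involutive purple = refl
other-involutive blue   = refl

other-≢ : ∀ c → other c ≢ c
other-≢ purple ()
other-≢ blue   ()

≢⇒≡other : ∀ {c c′} → c′ ≢ c → c′ ≡ other c
≢⇒≡other {purple} {purple} c′≢c = ⊥-elim (c′≢c refl)
≢⇒≡other {purple} {blue}   _    = refl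
≢⇒≡other {blue}   {purple} _    = refl
≢⇒≡other {blue}   {blue}   c′≢c = ⊥-elim (c′≢c refl)

≢⇒other≡ : ∀ {c c′} → c′ ≢ c → other c′ ≡ c
≢⇒other≡ {c} c′≢c = trans (cong other (≢⇒≡other c′≢c)) (other-involutive c)

_≟ᶜ_ : DecidableEquality Color
purple ≟ᶜ purple = yes refl
purple ≟ᶜ blue   = no λ ()
blue   ≟ᶜ purple = no λ ()
blue   ≟ᶜ blue   = yes refl

_≟ₘ_ : DecidableEquality (Maybe Color)
_≟ₘ_ = ≡-dec _≟ᶜ_

nothing≢just : ∀ {m : Maybe Color} {c} → m ≡ nothing → m ≢ just c
nothing≢just refl ()

coloured? : (m : Maybe Color) → Dec (∃[ c ] m ≡ just c)
coloured? nothing  = no λ { (_ , ()) }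
coloured? (just c) = yes (c , refl)

uncoloured-neither : (m : Maybe Color) {c : Color} → m ≢ just c → m ≢ just (other c) → m ≡ nothing
uncoloured-neither nothing  _ _ = refl
uncoloured-neither (just c′) m≢c m≢c̄ = ⊥-elim (m≢c̄ (cong just (≢⇒≡other (m≢c ∘ cong just))))

¬coloured⇒nothing : (m : Maybe Color) → ¬ (∃[ c ] m ≡ just c) → m ≡ nothing
¬coloured⇒nothing nothing  _  = refl
¬coloured⇒nothing (just c) ¬c = ⊥-elim (¬c (c , refl))

module _ {n : ℕ} (σ : Coloring n) where

  [≔]-updated : ∀ v c → (σ [ v ≔ c ]) v ≡ just c
  [≔]-updated v c with v ≟ v
  ... | yes _  = refl
  ... | no v≢v = ⊥-elim (v≢v refl)

  [≔]-unchanged : ∀ {v w} c → w ≢ v → (σ [ v ≔ c ]) w ≡ σ w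
  [≔]-unchanged {v} {w} c w≢v with w ≟ v
  ... | yes w≡v = ⊥-elim (w≢v w≡v)
  ... | no _    = refl

  [≔]-≢ : ∀ {v w c c′} → c′ ≢ c → σ w ≢ just c → (σ [ v ≔ c′ ]) w ≢ just c
  [≔]-≢ {v} {w} c′≢c σw≢c with w ≟ v
  ... | yes _ = c′≢c ∘ just-injective
  ... | no _  = σw≢c

-- Termination measure of the game: every move colours a new vertex.

blank : Maybe Color → ℕ
blank nothing  = 1
blank (just _) = 0

uncoloured : ∀ {n} → Coloring n → ℕ
uncoloured {zero}  σ = 0
uncoloured {suc n} σ = blank (σ zero) + uncoloured (σ ∘ suc)

blank-mono : ∀ (a b : Maybe Color) → (b ≡ nothing → a ≡ nothing) → blank b ≤ blank a
blank-mono a nothing  b⇒a rewrite b⇒a refl = ≤-refl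
blank-mono a (just _) _   = z≤n

uncoloured-mono : ∀ {n} (σ τ : Coloring n) → (∀ w → τ w ≡ nothing → σ w ≡ nothing) →
                  uncoloured τ ≤ uncoloured σ
uncoloured-mono {zero}  σ τ _   = z≤n
uncoloured-mono {suc n} σ τ τ⇒σ =
  +-mono-≤ (blank-mono (σ zero) (τ zero) (τ⇒σ zero)) (uncoloured-mono (σ ∘ suc) (τ ∘ suc) (τ⇒σ ∘ suc))

uncoloured-strict : ∀ {n} (σ τ : Coloring n) v {c} → (∀ w → τ w ≡ nothing → σ w ≡ nothing) →
                    σ v ≡ nothing → τ v ≡ just c → uncoloured τ < uncoloured σ
uncoloured-strict σ τ zero τ⇒σ σv τv rewrite σv | τv =
  s≤s (uncoloured-mono (σ ∘ suc) (τ ∘ suc) (τ⇒σ ∘ suc))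
uncoloured-strict σ τ (suc v) τ⇒σ σv τv =
  +-mono-≤-< (blank-mono (σ zero) (τ zero) (τ⇒σ zero)) (uncoloured-strict (σ ∘ suc) (τ ∘ suc) v (τ⇒σ ∘ suc) σv τv)

uncoloured-[≔] : ∀ {n} (σ : Coloring n) {v c} → σ v ≡ nothing → uncoloured (σ [ v ≔ c ]) < uncoloured σ
uncoloured-[≔] σ {v} {c} σv = uncoloured-strict σ (σ [ v ≔ c ]) v still-blank σv ([≔]-updated σ v c)
  where
  still-blank : ∀ w → (σ [ v ≔ c ]) w ≡ nothing → σ w ≡ nothing
  still-blank w τw with w ≟ v
  ... | no _ = τw

by-≟ : ∀ {n} {A : Set} (x y : Fin n) → (x ≡ y → A) → (x ≢ y → A) → A
by-≟ x y x≡y⇒A x≢y⇒A with x ≟ y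
... | yes x≡y = x≡y⇒A x≡y
... | no x≢y  = x≢y⇒A x≢y

∀≢⇒∀ : ∀ {n} {P : Fin n → Set} x → P x → (∀ z → z ≢ x → P z) → ∀ z → P z
∀≢⇒∀ x Px P≢ z = by-≟ z x (λ { refl → Px }) (P≢ z)

module _ {n : ℕ} (G : SimpleGraph n) where

  adj? : ∀ u v → Dec (Adj G u v)
  adj? u v = adj G u v Bool.≟ true

  inN? : ∀ v u → Dec (InN G v u)
  inN? v u = (u ≟ v) ⊎-dec adj? v u

  Adj-sym : ∀ {u v} → Adj G u v → Adj G v u
  Adj-sym {u} {v} uv = trans (symm G v u) uv

  Adj⇒≢ : ∀ {u v} → Adj G u v → u ≢ v
  Adj⇒≢ {u} uu refl with trans (sym uu) (loopless G u)
  ... | ()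

  Supported : Coloring n → Fin n → Set
  Supported σ z = ∀ {c} → σ z ≡ just c → ∃[ w ] (Adj G z w × σ w ≡ just (other c))

  OpenAt : Coloring n → Fin n → Set
  OpenAt σ z = ∀ {c} → σ z ≡ just c → ∃[ w ] (Adj G z w × σ w ≢ just c)

  Open : Coloring n → Set
  Open σ = ∀ z → OpenAt σ z

  AllSupported : Coloring n → Set
  AllSupported σ = ∀ z → Supported σ z

  SupportedExcept : Coloring n → Fin n → Set
  SupportedExcept σ x = ∀ z → z ≢ x → Supported σ z

  supported-by : ∀ {σ z w c} → σ z ≡ just c → Adj G z w → σ w ≡ just (other c) → Supported σ z
  supported-by σz zw σw σz′ with just-injective (trans (sym σz) σz′)
  ... | refl = _ , zw , σw

  openAt-by : ∀ {σ z w c} → σ z ≡ just c → Adj G z w → σ w ≢ just c → OpenAt σ z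
  openAt-by σz zw σw σz′ with just-injective (trans (sym σz) σz′)
  ... | refl = _ , zw , σw

  supported⇒openAt : ∀ {σ z} → Supported σ z → OpenAt σ z
  supported⇒openAt s {c} σz with s σz
  ... | w , zw , σw = w , zw , λ σw′ → other-≢ c (just-injective (trans (sym σw) σw′))

  open-except : ∀ {σ x} → SupportedExcept σ x → OpenAt σ x → Open σ
  open-except {x = x} s ox z with z ≟ x
  ... | yes refl = ox
  ... | no z≢x   = supported⇒openAt (s z z≢x)

  open-except₂ : ∀ {σ x u} → (∀ z → z ≢ x → z ≢ u → Supported σ z) → OpenAt σ x → OpenAt σ u → Open σ
  open-except₂ {x = x} {u} s ox ou z with z ≟ x | z ≟ u
  ... | yes refl | _        = ox
  ... | no _     | yes refl = ou
  ... | no z≢x   | no z≢u   = supported⇒openAt (s z z≢x z≢u)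

  open⇒¬SepyWon : ∀ {σ} → Open σ → ¬ SepyWon G σ
  open⇒¬SepyWon o (v , c , mono) with o v (mono v (inj₁ refl))
  ... | w , vw , σw = σw (mono w (inj₂ vw))

  supported-[≔] : ∀ {σ v z c} → σ v ≡ nothing → z ≢ v → Supported σ z → Supported (σ [ v ≔ c ]) z
  supported-[≔] {σ} {v} {z} {c} σv z≢v s τz with s (trans (sym ([≔]-unchanged σ c z≢v)) τz)
  ... | w , zw , σw = w , zw , trans ([≔]-unchanged σ c w≢v) σw
    where
    w≢v : w ≢ v
    w≢v refl = nothing≢just σv σw

  answer-supports : ∀ {σ v z f y} → σ v ≡ nothing → Adj G z v → σ z ≡ just f →
                    (y ≢ z → Supported σ y) → Supported (σ [ v ≔ other f ]) y
  answer-supports {σ} {v} {z} {f} {y} σv zv σz s =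
    by-≟ {A = Supported τ y} y v (λ { refl → supported-by τv (Adj-sym zv) τz }) λ y≢v →
    by-≟ {A = Supported τ y} y z (λ { refl → supported-by (trans ([≔]-unchanged σ (other f) y≢v) σz) zv τv })
      (supported-[≔] σv y≢v ∘ s)
    where
    τ : Coloring n
    τ = σ [ v ≔ other f ]
    τv : τ v ≡ just (other f)
    τv = [≔]-updated σ v (other f)
    τz : τ z ≡ just (other (other f))
    τz = trans ([≔]-unchanged σ (other f) (Adj⇒≢ zv)) (trans σz (cong just (sym (other-involutive f))))

  TwoNeighbours : Fin n → Set
  TwoNeighbours u = ∃[ a ] ∃[ b ] (Adj G u a × Adj G u b × a ≢ b)

  Insulated : Fin n → Set
  Insulated u = ∀ {w x} → Adj G u w → Adj G w x → x ≡ u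

  Robust : Fin n → Set
  Robust u = TwoNeighbours u ⊎ Insulated u

  another-neighbour : ∀ {u} → TwoNeighbours u → ∀ y → ∃[ b ] (Adj G u b × b ≢ y)
  another-neighbour (a , b , ua , ub , a≢b) y =
    by-≟ a y (λ { refl → b , ub , a≢b ∘ sym }) (λ a≢y → a , ua , a≢y)

  insulated-blocks : ∀ {σ u x c} → Insulated u → σ u ≡ just c → Adj G u x → ¬ Legal G σ x c
  insulated-blocks {x = x} ins σu ux (_ , .x , inj₁ refl , avoid) = avoid _ (inj₂ (Adj-sym ux)) σu
  insulated-blocks ins σu ux (_ , w , inj₂ xw , avoid) with ins ux xw
  ... | refl = avoid _ (inj₁ refl) σu

  record Pending (σ : Coloring n) (u : Fin n) : Set where
    field
      others   : SupportedExcept σ u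
      colour   : Color
      coloured : σ u ≡ just colour
      free : ∀ w → Adj G u w → σ w ≡ nothing
      robust   : Robust u

  record Defect (σ : Coloring n) (x : Fin n) : Set where
    field
      others   : SupportedExcept σ x
      colour   : Color
      coloured : σ x ≡ just colour
      escape   : ∃[ w ] (Adj G x w × σ w ≢ just colour)

  Stable : Coloring n → Set
  Stable σ = AllSupported σ ⊎ ∃ (Pending σ)

  Recoverable : Coloring n → Set
  Recoverable σ = AllSupported σ ⊎ ∃ (Defect σ)

  defect⇒open : ∀ {σ x} → Defect σ x → Open σ
  defect⇒open record { others = s ; coloured = σx ; escape = _ , xw , σw } =
    open-except s (openAt-by σx xw σw)

  Move : Coloring n → (Coloring n → Set) → Set
  Move σ P = ∃[ v ] ∃[ c ] (Legal G σ v c × P (σ [ v ≔ c ]))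

  Undominated : Coloring n → Set
  Undominated σ = ∃[ c ] ∃[ u ] (∀ w → InN G u w → σ w ≢ just c)

  undominated⇒¬DomWon : ∀ {σ} → Undominated σ → ¬ DomWon G σ
  undominated⇒¬DomWon (c , u , avoid) dom with dom c u
  ... | w , uw , σw = avoid w uw σw

  dominated-by? : ∀ (σ : Coloring n) c v → Dec (∃[ w ] (InN G v w × σ w ≡ just c))
  dominated-by? σ c v = any? λ w → inN? v w ×-dec (σ w ≟ₘ just c)

  ¬dominating⇒avoided : ∀ {σ c} → ¬ Dominating G σ c → ∃[ u ] (∀ w → InN G u w → σ w ≢ just c)
  ¬dominating⇒avoided {σ} {c} ¬dom with ¬∀⟶∃¬ n _ (dominated-by? σ c) ¬dom
  ... | u , ¬dominated = u , λ w uw σw → ¬dominated (w , uw , σw)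

  dominated? : ∀ (σ : Coloring n) → DomWon G σ ⊎ Undominated σ
  dominated? σ with all? (dominated-by? σ purple) | all? (dominated-by? σ blue)
  ... | no ¬p | _     = inj₂ (purple , ¬dominating⇒avoided ¬p)
  ... | yes _ | no ¬b = inj₂ (blue , ¬dominating⇒avoided ¬b)
  ... | yes p | yes b = inj₁ λ { purple → p ; blue → b }

  legal-beside-blank : ∀ {σ u v c} → σ u ≡ nothing → (∀ w → Adj G u w → σ w ≡ nothing) →
                       InN G v u → σ v ≡ nothing → Legal G σ v c
  legal-beside-blank σu free vu σv =
    σv , _ , vu , λ { _ (inj₁ refl) → nothing≢just σu ; w (inj₂ uw) → nothing≢just (free w uw) }

  legal-answer : ∀ {σ u v c} → σ u ≡ just c → (∀ w → Adj G u w → σ w ≢ just (other c)) →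
                 InN G v u → σ v ≡ nothing → Legal G σ v (other c)
  legal-answer {c = c} σu avoid vu σv =
    σv , _ , vu , λ { _ (inj₁ refl) σu′ → other-≢ c (just-injective (trans (sym σu′) σu)) ; w (inj₂ uw) → avoid w uw }

  coloured-neighbour⊎free : ∀ (σ : Coloring n) u →
                                ∃[ w ] (Adj G u w × ∃[ f ] σ w ≡ just f) ⊎ (∀ w → Adj G u w → σ w ≡ nothing)
  coloured-neighbour⊎free σ u with any? (λ w → adj? u w ×-dec coloured? (σ w))
  ... | yes found  = inj₁ found
  ... | no ¬found = inj₂ λ w uw → ¬coloured⇒nothing (σ w) λ f → ¬found (w , uw , f)

  opposite-neighbour? : ∀ (σ : Coloring n) x e → Dec (∃[ y ] (Adj G x y × σ y ≡ just (other e)))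
  opposite-neighbour? σ x e = any? λ y → adj? x y ×-dec (σ y ≟ₘ just (other e))

  answer-escape : ∀ {σ x w e} → σ x ≡ just e → Adj G x w → σ w ≢ just e →
                  ¬ (∃[ y ] (Adj G x y × σ y ≡ just (other e))) → σ w ≡ nothing × Legal G σ w (other e)
  answer-escape {σ} {x} {w} {e} σx xw σw ¬opposite = σw-blank , legal-answer σx avoid (inj₂ (Adj-sym xw)) σw-blank
    where
    avoid : ∀ y → Adj G x y → σ y ≢ just (other e)
    avoid y xy σy = ¬opposite (y , xy , σy)
    σw-blank : σ w ≡ nothing
    σw-blank = uncoloured-neither (σ w) σw (avoid w xw)

  avoided⇒uncoloured : ∀ {σ u c} → AllSupported σ → (∀ w → InN G u w → σ w ≢ just c) → σ u ≡ nothing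
  avoided⇒uncoloured {σ} {u} {c} s avoid with σ u in σu
  ... | nothing = refl
  ... | just e with s u σu
  ...   | w , uw , σw = ⊥-elim (avoid w (inj₂ uw) (trans σw (cong just (≢⇒other≡ e≢c))))
    where
    e≢c : e ≢ c
    e≢c e≡c = avoid u (inj₁ refl) (trans σu (cong just e≡c))

  pending-[≔] : ∀ {σ u c} → AllSupported σ → σ u ≡ nothing → (∀ w → Adj G u w → σ w ≡ nothing) →
                Robust u → Pending (σ [ u ≔ c ]) u
  pending-[≔] {σ} {u} {c} s σu free r = record
    { others   = λ z z≢u → supported-[≔] σu z≢u (s z)
    ; colour   = c
    ; coloured = [≔]-updated σ u c
    ; free = λ w uw → trans ([≔]-unchanged σ c (Adj⇒≢ (Adj-sym uw))) (free w uw)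
    ; robust   = r
    }

  defect-step : ∀ {σ x} → Defect σ x → AllSupported σ ⊎ Move σ AllSupported
  defect-step {σ} {x} record { others = s ; colour = e ; coloured = σx ; escape = w , xw , σw }
    with opposite-neighbour? σ x e
  ... | yes (y , xy , σy) = inj₁ (∀≢⇒∀ x (supported-by σx xy σy) s)
  ... | no ¬opposite with answer-escape σx xw σw ¬opposite
  ...   | σw-blank , legal-w = inj₂ (w , other e , legal-w , λ z → answer-supports σw-blank xw σx (s z))

  module _ (noIso : NoIsolatedVertices G) where

    pending⇒open : ∀ {σ u} → Pending σ u → Open σ
    pending⇒open {u = u} record { others = s ; coloured = σu ; free = free } with noIso u
    ... | a , ua = open-except s (openAt-by σu ua (nothing≢just (free a ua)))

    stable⇒open : ∀ {σ} → Stable σ → Open σ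
    stable⇒open (inj₁ s) z     = supported⇒openAt (s z)
    stable⇒open (inj₂ (_ , p)) = pending⇒open p

    robust⊎pendant : ∀ u → Robust u ⊎ ∃[ a ] ∃[ b ] (Adj G u a × Adj G a b × b ≢ u)
    robust⊎pendant u with noIso u
    ... | a , ua with any? (λ b → adj? u b ×-dec ¬? (b ≟ a))
    ...   | yes (b , ub , b≢a) = inj₁ (inj₁ (a , b , ua , ub , b≢a ∘ sym))
    ...   | no ¬two with any? (λ b → adj? a b ×-dec ¬? (b ≟ u))
    ...     | yes (b , ab , b≢u) = inj₂ (a , b , ua , ab , b≢u)
    ...     | no ¬far = inj₁ (inj₂ insulated)
      where
      insulated : Insulated u
      insulated {w} {x} uw wx with w ≟ a | x ≟ u
      ... | _        | yes x≡u = x≡u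
      ... | yes refl | no x≢u  = ⊥-elim (¬far (x , wx , x≢u))
      ... | no w≢a   | no _    = ⊥-elim (¬two (w , uw , w≢a))

    legal⇒escape : ∀ {σ x e} → Legal G σ x e → ∃[ w ] (Adj G x w × σ w ≢ just e)
    legal⇒escape {x = x} (_ , .x , inj₁ refl , avoid) with noIso x
    ... | w , xw = w , xw , avoid w (inj₂ xw)
    legal⇒escape (_ , u , inj₂ xu , avoid) = u , xu , avoid u (inj₁ refl)

    blank-neighbourhood-step : ∀ {σ u c} → AllSupported σ → σ u ≡ nothing → (∀ w → Adj G u w → σ w ≡ nothing) →
                    (∀ w → InN G u w → σ w ≢ just c) → Move σ Stable
    blank-neighbourhood-step {σ} {u} {c} s σu free avoid with robust⊎pendant u
    ... | inj₁ r = u , c , (σu , u , inj₁ refl , avoid) , inj₂ (u , pending-[≔] s σu free r)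
    ... | inj₂ (a , b , ua , ab , b≢u) with coloured-neighbour⊎free σ a
    ...   | inj₁ (z , az , f , σz) =
            a , other f , legal-beside-blank σu free (inj₂ (Adj-sym ua)) (free a ua) ,
            inj₁ λ y → answer-supports (free a ua) (Adj-sym az) σz (λ _ → s y)
    ...   | inj₂ a-free =
            a , c , legal-beside-blank σu free (inj₂ (Adj-sym ua)) (free a ua) ,
            inj₂ (a , pending-[≔] s (free a ua) a-free (inj₁ (u , b , Adj-sym ua , ab , b≢u ∘ sym)))

    allSupported-step : ∀ {σ} → AllSupported σ → Undominated σ → Move σ Stable
    allSupported-step {σ} s (c , u , avoid) with coloured-neighbour⊎free σ u
    ... | inj₁ (z , uz , f , σz) = u , c , (σu , u , inj₁ refl , avoid) , inj₁ answered
      where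
      σu : σ u ≡ nothing
      σu = avoided⇒uncoloured s avoid
      other-f≡c : other f ≡ c
      other-f≡c = ≢⇒other≡ λ f≡c → avoid z (inj₂ uz) (trans σz (cong just f≡c))
      answered : AllSupported (σ [ u ≔ c ])
      answered y = subst (λ c′ → Supported (σ [ u ≔ c′ ]) y) other-f≡c
                     (answer-supports σu (Adj-sym uz) σz (λ _ → s y))
    ... | inj₂ free = blank-neighbourhood-step s (avoided⇒uncoloured s avoid) free avoid

    pending-step : ∀ {σ u} → Pending σ u → Move σ AllSupported
    pending-step {u = u} record { others = s ; coloured = σu ; free = free } with noIso u
    ... | a , ua = a , _ , legal-answer σu (λ w uw → nothing≢just (free w uw)) (inj₂ (Adj-sym ua)) (free a ua)
                 , λ y → answer-supports (free a ua) ua σu (s y)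

    stable-step : ∀ {σ} → Stable σ → Undominated σ → Move σ Stable
    stable-step (inj₁ s) und = allSupported-step s und
    stable-step (inj₂ (_ , p)) _ with pending-step p
    ... | v , c , l , s = v , c , l , inj₁ s

    module AfterSepy {σ : Coloring n} {x : Fin n} {e : Color} (legal : Legal G σ x e) where

      τ : Coloring n
      τ = σ [ x ≔ e ]

      σx : σ x ≡ nothing
      σx = proj₁ legal

      τx : τ x ≡ just e
      τx = [≔]-updated σ x e

      τ-escape : ∃[ w ] (Adj G x w × τ w ≢ just e)
      τ-escape with legal⇒escape legal
      ... | w , xw , σw = w , xw , σw ∘ trans (sym ([≔]-unchanged σ e (Adj⇒≢ (Adj-sym xw))))

      τ-openAt-x : OpenAt τ x
      τ-openAt-x with τ-escape
      ... | w , xw , τw = openAt-by τx xw τw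

      from-allSupported : AllSupported σ → Defect τ x
      from-allSupported s = record
        { others   = λ z z≢x → supported-[≔] σx z≢x (s z)
        ; colour   = e
        ; coloured = τx
        ; escape   = τ-escape
        }

      module FromPending {u : Fin n} (p : Pending σ u) where
        open Pending p renaming (colour to c; coloured to σu)

        x≢u : x ≢ u
        x≢u refl = nothing≢just σx σu

        τu : τ u ≡ just c
        τu = trans ([≔]-unchanged σ e (x≢u ∘ sym)) σu

        τ-others : ∀ z → z ≢ x → z ≢ u → Supported τ z
        τ-others z z≢x z≢u = supported-[≔] σx z≢x (others z z≢u)

        τ-open : ∀ {w} → Adj G u w → τ w ≡ nothing → Open τ
        τ-open uw τw = open-except₂ τ-others τ-openAt-x (openAt-by τu uw (nothing≢just τw))

        -- Sepy repeated u's colour next to u: Dom answers at another free neighbour b of u.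
        adjacent-same : Adj G u x → e ≡ c → Open τ × Move τ Recoverable
        adjacent-same ux e≡c with robust
        ... | inj₂ ins = ⊥-elim (insulated-blocks ins σu ux (subst (Legal G σ x) e≡c legal))
        ... | inj₁ two with another-neighbour two x
        ...   | b , ub , b≢x = τ-open ub τb , b , other c , legal-b , inj₂ (x , defect)
          where
          e≢c̄ : e ≢ other c
          e≢c̄ e≡c̄ = other-≢ c (trans (sym e≡c̄) e≡c)
          τb : τ b ≡ nothing
          τb = trans ([≔]-unchanged σ e b≢x) (free b ub)
          legal-b : Legal G τ b (other c)
          legal-b = legal-answer τu (λ y uy → [≔]-≢ σ e≢c̄ (nothing≢just (free y uy))) (inj₂ (Adj-sym ub)) τb
          defect : Defect (τ [ b ≔ other c ]) x
          defect with τ-escape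
          ... | w , xw , τw = record
            { others   = λ z z≢x → answer-supports τb ub τu (τ-others z z≢x)
            ; colour   = e
            ; coloured = trans ([≔]-unchanged τ (other c) (b≢x ∘ sym)) τx
            ; escape   = w , xw , [≔]-≢ τ {v = b} {w} (e≢c̄ ∘ sym) τw
            }

        adjacent : Adj G u x → Recoverable τ ⊎ (Open τ × Move τ Recoverable)
        adjacent ux with e ≟ᶜ c
        ... | yes e≡c = inj₂ (adjacent-same ux e≡c)
        ... | no e≢c  = inj₁ (inj₁ answered)
          where
          answered : AllSupported τ
          answered y = subst (λ e′ → Supported (σ [ x ≔ e′ ]) y) (sym (≢⇒≡other e≢c))
                         (answer-supports σx ux σu (others y))

        module Distant (¬ux : ¬ Adj G u x) where

          τ-free : ∀ w → Adj G u w → τ w ≡ nothing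
          τ-free w uw = trans ([≔]-unchanged σ {x} {w} e λ { refl → ¬ux uw }) (free w uw)

          neighbour-besides : ∀ {w} → Adj G x w → ∃[ b ] (Adj G u b × b ≢ w)
          neighbour-besides {w} xw with adj? u w | noIso u
          ... | no ¬uw | a , ua = a , ua , λ { refl → ¬uw ua }
          ... | yes uw | _ with robust
          ...   | inj₁ two = another-neighbour two w
          ...   | inj₂ ins = ⊥-elim (x≢u (ins uw (Adj-sym xw)))

          defect-after-answer : ∀ {w} → Adj G x w → τ w ≡ nothing → Defect (τ [ w ≔ other e ]) u
          defect-after-answer {w} xw τw with neighbour-besides xw
          ... | b , ub , b≢w = record
            { others   = λ y y≢u → answer-supports τw xw τx (λ y≢x → τ-others y y≢x y≢u)
            ; colour   = c
            ; coloured = trans ([≔]-unchanged τ {w} {u} (other e) λ { refl → nothing≢just τw τu }) τu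
            ; escape   = b , ub , nothing≢just (trans ([≔]-unchanged τ (other e) b≢w) (τ-free b ub))
            }

          distant : Recoverable τ ⊎ (Open τ × Move τ Recoverable)
          distant with noIso u | opposite-neighbour? τ x e
          ... | a , ua | yes (y , xy , τy) = inj₁ (inj₂ (u , record
                { others   = ∀≢⇒∀ {P = λ z → z ≢ u → Supported τ z} x (λ _ → supported-by τx xy τy) τ-others
                ; colour   = c
                ; coloured = τu
                ; escape   = a , ua , nothing≢just (τ-free a ua)
                }))
          ... | a , ua | no ¬opposite with τ-escape
          ...   | w , xw , τw with answer-escape τx xw τw ¬opposite
          ...     | τw-blank , legal-w =
                    inj₂ (τ-open ua (τ-free a ua) ,
                          w , other e , legal-w , inj₂ (u , defect-after-answer xw τw-blank))

      after-sepy : Stable σ → Recoverable τ ⊎ (Open τ × Move τ Recoverable)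
      after-sepy (inj₁ s) = inj₁ (inj₂ (x , from-allSupported s))
      after-sepy (inj₂ (u , p)) with adj? u x
      ... | yes ux = FromPending.adjacent p ux
      ... | no ¬ux = FromPending.Distant.distant p ¬ux

    module Strategy (k : ℕ) where

      DF : Phase → Coloring n → Set
      DF = DomForces G (suc (suc k))

      DomWinsBelow : ℕ → Set
      DomWinsBelow b = ∀ σ → uncoloured σ < b → Stable σ → DF sepyPhase σ

      DomWinsBelow-anti : ∀ {a b} → a ≤ b → DomWinsBelow b → DomWinsBelow a
      DomWinsBelow-anti a≤b ih σ σ<a = ih σ (<-≤-trans σ<a a≤b)

      ongoing : ∀ {σ} → Open σ → Undominated σ → Ongoing G σ
      ongoing o und = open⇒¬SepyWon o , undominated⇒¬DomWon und

      dom-step : ∀ {j σ} {P : Coloring n → Set} → Open σ → (Undominated σ → Move σ P) →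
                 (∀ σ′ → P σ′ → DomWinsBelow (suc (uncoloured σ′)) → DF (domPhase j) σ′) →
                 DomWinsBelow (uncoloured σ) → DF (domPhase (suc j)) σ
      dom-step {σ = σ} o move continue ih with dominated? σ
      ... | inj₁ dom = won dom
      ... | inj₂ und with move und
      ...   | v , c , l , P′ = domMove v c (ongoing o und) l
                                (continue _ P′ (DomWinsBelow-anti (uncoloured-[≔] σ (proj₁ l)) ih))

      dom-turn : ∀ j σ → Stable σ → DomWinsBelow (suc (uncoloured σ)) → DF (domPhase j) σ
      dom-turn zero σ s ih with dominated? σ
      ... | inj₁ dom = won dom
      ... | inj₂ und = domEnd (ongoing (stable⇒open s) und) (ih σ ≤-refl s)
      dom-turn (suc j) σ s ih =
        dom-step (stable⇒open s) (stable-step s) (dom-turn j) (DomWinsBelow-anti (n≤1+n _) ih)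

      recover-turn : ∀ j σ → Recoverable σ → DomWinsBelow (suc (uncoloured σ)) → DF (domPhase (suc j)) σ
      recover-turn j σ (inj₁ s) ih = dom-turn (suc j) σ (inj₁ s) ih
      recover-turn j σ (inj₂ (_ , δ)) ih with defect-step δ
      ... | inj₁ s  = dom-turn (suc j) σ (inj₁ s) ih
      ... | inj₂ mv = dom-step (defect⇒open δ) (const mv) (λ σ′ s → dom-turn j σ′ (inj₁ s))
                        (DomWinsBelow-anti (n≤1+n _) ih)

      answer-sepy : ∀ {σ x e} → Stable σ → (l : Legal G σ x e) →
                    DomWinsBelow (suc (uncoloured (σ [ x ≔ e ]))) → DF (domPhase (suc (suc k))) (σ [ x ≔ e ])
      answer-sepy s l ih with AfterSepy.after-sepy l s
      ... | inj₁ r        = recover-turn (suc k) _ r ih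
      ... | inj₂ (o , mv) = dom-step o (const mv) (recover-turn k) (DomWinsBelow-anti (n≤1+n _) ih)

      domWinsBelow : ∀ b → DomWinsBelow b
      domWinsBelow (suc b) σ (s≤s σ≤b) s with dominated? σ
      ... | inj₁ dom = won dom
      ... | inj₂ und = sepyTurn (ongoing (stable⇒open s) und)
        (dom-step (stable⇒open s) (stable-step s) (dom-turn (suc k)) (DomWinsBelow-anti σ≤b (domWinsBelow b)))
        (λ x e l → answer-sepy s l (DomWinsBelow-anti (<-≤-trans (uncoloured-[≔] σ (proj₁ l)) σ≤b) (domWinsBelow b)))

empty-allSupported : ∀ {n} (G : SimpleGraph n) → AllSupported G emptyColoring
empty-allSupported G z ()

mainTheorem3 : (d : ℕ) → 2 ≤ d → (n : ℕ) → (G : SimpleGraph n) → NoIsolatedVertices G →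
    DomForces G d (domPhase d) emptyColoring × DomForces G d sepyPhase emptyColoring
mainTheorem3 (suc (suc k)) (s≤s (s≤s _)) n G noIso =
  dom-turn (suc (suc k)) emptyColoring empty (domWinsBelow _) ,
  domWinsBelow _ emptyColoring ≤-refl empty
  where
  open Strategy G noIso k
  empty : Stable G emptyColoring
  empty = inj₁ (empty-allSupported G)
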